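{- Let $X$ and $Y$ be finite nonempty sets and let $F: X \to 2^Y$ be a set-valued mapping. The following are equivalent: (i) $F$ satisfies the Hall condition; (ii) $F$ admits a Hall partition; (iii) $F$ admits an alldifferent selection.
   Context: A set-valued mapping $F: X \to 2^Y$ assigns to each $x$ a (possibly empty) subset $F(x) \subset Y$; $F(W) = \bigcup_{x\in W}F(x)$; $\sharp$ is cardinality. $F$ satisfies the Hall condition if $\sharp F(W)\ge\sharp W$ for all $W\subset X$. A selection of $F$ is a map $s: X\to Y$ with $s(x)\in F(x)$ for all $x$; it is alldifferent if it is injective. For $W \subset X$, $F_W: X\setminus W \to 2^Y$ is $F_W(x) = F(x) \setminus F(W)$. For any set-valued $G$ on a finite set, a subset $W$ of its domain is critical for $G$ if $W\ne\emptyset$ and $\sharp G(W)=\sharp W$, and non-reducible for $G$ if $W\ne\emptyset$ and no proper subset of $W$ is critical for $G$. A tuple $(W_1,\ldots,W_m)$, $m\ge1$, is a Hall partition of $F$ if the $W_i$ are nonempty, pairwise disjoint with union $X$, and with $G_i = F_{W_1\cup\cdots\cup W_{i-1}}$ ($G_1=F$): (i) $G_i(x)\neq\emptyset$ for $x \in W_i$, all $i$; (ii) $W_i$ is non-reducible for $G_i$, all $i$; (iii) $W_i$ is critical for $G_i$ for $i \le m-1$. -}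

module Defs where

open import Data.Nat using (ℕ; zero; suc; _<_; _≤_)
open import Data.Bool using (true; false)
open import Data.Fin using (Fin; toℕ) renaming (zero to fzero; suc to fsuc)
open import Data.Fin.Subset
  using (Subset; _∈_; _⊆_; _⊂_; _∪_; _∩_; _─_; ∁; ∣_∣; Nonempty; ⊥; ⊤)
open import Data.Vec using (_∷_)
open import Data.Product using (_×_; Σ; ∃)
open import Relation.Binary.PropositionalEquality using (_≡_; _≢_)
open import Relation.Nullary using (¬_)
open import Function.Definitions using (Injective)

SetMap : ℕ → ℕ → Set
SetMap n k = Fin n → Subset k

img : ∀ {n k} → SetMap n k → Subset n → Subset k
img {zero}  F W = ⊥
img {suc n} F (true  ∷ W) = F fzero ∪ img (λ x → F (fsuc x)) W
img {suc n} F (false ∷ W) = img (λ x → F (fsuc x)) W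

HallCondition : ∀ {n k} → SetMap n k → Set
HallCondition {n} F = (W : Subset n) → ∣ W ∣ ≤ ∣ img F W ∣

IsSelection : ∀ {n k} → SetMap n k → (Fin n → Fin k) → Set
IsSelection F s = ∀ x → s x ∈ F x

HasAlldifferentSelection : ∀ {n k} → SetMap n k → Set
HasAlldifferentSelection {n} {k} F =
  Σ (Fin n → Fin k) (λ s → IsSelection F s × Injective _≡_ _≡_ s)

-- The reduced mapping F_W : X ∖ W → 2^Y,  F_W(x) = F(x) ∖ F(W).
-- Represented as a mapping on all of Fin n together with its domain X ∖ W = ∁ W;
-- only its values on the domain are ever used.
reduce : ∀ {n k} → SetMap n k → Subset n → SetMap n k
reduce F W x = F x ─ img F W

Critical : ∀ {n k} → Subset n → SetMap n k → Subset n → Set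
Critical D G W = W ⊆ D × Nonempty W × ∣ img G W ∣ ≡ ∣ W ∣

NonReducible : ∀ {n k} → Subset n → SetMap n k → Subset n → Set
NonReducible D G W = W ⊆ D × Nonempty W × (∀ V → V ⊂ W → ¬ Critical D G V)

prefixUnion : ∀ {n m} → (Fin m → Subset n) → ℕ → Subset n
prefixUnion {n} {zero}  Ws i       = ⊥
prefixUnion {n} {suc m} Ws zero    = ⊥
prefixUnion {n} {suc m} Ws (suc i) = Ws fzero ∪ prefixUnion (λ j → Ws (fsuc j)) i

-- (W_1, …, W_m), m ≥ 1 (here m = suc m', indexed by Fin (suc m')), is a Hall
-- partition of F.  G_i = F_{W_1 ∪ … ∪ W_{i-1}} with domain X ∖ (W_1 ∪ … ∪ W_{i-1}).
record IsHallPartition {n k m'} (F : SetMap n k) (Ws : Fin (suc m') → Subset n) : Set where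
  field
    nonempty  : ∀ i → Nonempty (Ws i)
    disjoint  : ∀ i j → i ≢ j → Ws i ∩ Ws j ≡ ⊥
    covers    : ∀ x → ∃ (λ i → x ∈ Ws i)
    condI     : ∀ i x → x ∈ Ws i →
                  Nonempty (reduce F (prefixUnion Ws (toℕ i)) x)
    condII    : ∀ i → NonReducible (∁ (prefixUnion Ws (toℕ i)))
                                   (reduce F (prefixUnion Ws (toℕ i))) (Ws i)
    condIII   : ∀ i → suc (toℕ i) < suc m' →
                  Critical (∁ (prefixUnion Ws (toℕ i)))
                           (reduce F (prefixUnion Ws (toℕ i))) (Ws i)

HasHallPartition : ∀ {n k} → SetMap n k → Set
HasHallPartition {n} F =
  Σ ℕ (λ m' → Σ (Fin (suc m') → Subset n) (IsHallPartition F))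

-- Hall's marriage theorem is proved by the classical induction on the domain: either some
-- proper nonempty subset W is critical, and then F restricted to W and the reduced map F_W
-- on the rest both satisfy the Hall condition, or every proper subset has a surplus, and
-- then any value y ∈ F(x) can be committed to x without breaking the Hall condition.
--
-- A Hall partition is built by repeatedly removing a minimal critical set of the current
-- reduced map (removing a critical set preserves the Hall condition), the last block being
-- whatever is left once no proper critical set remains.  Conversely every block of a Hall
-- partition satisfies the Hall condition for its reduced map, since a non-reducible set with
-- nonempty values has a surplus on each proper nonempty subset; the block matchings then
-- glue, because the values on a block avoid the images of all earlier blocks.  An
-- alldifferent selection maps W injectively into F(W), which gives the Hall condition.
module Submission where

open import Defs
open import Data.Nat using (ℕ; zero; suc; _+_; _≤_; _<_; z≤n; s≤s)
import Data.Nat.Properties as ℕ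
open import Data.Bool using (true; false)
open import Data.Fin using (Fin; toℕ) renaming (zero to fzero; suc to fsuc)
open import Data.Fin.Properties using (toℕ-injective; suc-injective)
open import Data.Fin.Subset
open import Data.Fin.Subset.Properties
open import Data.Fin.Subset.Induction using (⊂-wellFounded; ⊃-wellFounded)
open import Data.Vec.Base using ([]; _∷_; here; there)
import Data.Vec.Functional as Vector
open import Data.Product using (_×_; _,_; proj₁; proj₂; Σ; ∃-syntax)
open import Data.Sum using (inj₁; inj₂; [_,_])
open import Data.Empty using (⊥-elim)
open import Function.Base using (_∘_)
open import Function.Bundles using (_⇔_; mk⇔)
open import Function.Definitions using (Injective)
open import Induction.WellFounded using (Acc; acc)
open import Relation.Binary.Definitions using (tri<; tri≈; tri>)
open import Relation.Binary.PropositionalEquality hiding ([_])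
open import Relation.Nullary using (¬_; yes; no)
open import Relation.Nullary.Decidable using (_×-dec_)
open import Relation.Unary using (Pred; Decidable)

private
  variable
    n k : ℕ

x∈p─q⇒x∉q : ∀ {x : Fin n} (p q : Subset n) → x ∈ p ─ q → x ∉ q
x∈p─q⇒x∉q (true  ∷ p) (false ∷ q) here      ()
x∈p─q⇒x∉q (_     ∷ p) (_     ∷ q) (there i) (there j) = x∈p─q⇒x∉q p q i j

∣p─q∣+∣q∣≡∣p∪q∣ : ∀ (p q : Subset n) → ∣ p ─ q ∣ + ∣ q ∣ ≡ ∣ p ∪ q ∣
∣p─q∣+∣q∣≡∣p∪q∣ []          []          = refl
∣p─q∣+∣q∣≡∣p∪q∣ (true  ∷ p) (true  ∷ q) =
  trans (ℕ.+-suc ∣ p ─ q ∣ ∣ q ∣) (cong suc (∣p─q∣+∣q∣≡∣p∪q∣ p q))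
∣p─q∣+∣q∣≡∣p∪q∣ (false ∷ p) (true  ∷ q) =
  trans (ℕ.+-suc ∣ p ─ q ∣ ∣ q ∣) (cong suc (∣p─q∣+∣q∣≡∣p∪q∣ p q))
∣p─q∣+∣q∣≡∣p∪q∣ (true  ∷ p) (false ∷ q) = cong suc (∣p─q∣+∣q∣≡∣p∪q∣ p q)
∣p─q∣+∣q∣≡∣p∪q∣ (false ∷ p) (false ∷ q) = ∣p─q∣+∣q∣≡∣p∪q∣ p q

∣p∣≤1+∣p-x∣ : ∀ (p : Subset n) x → ∣ p ∣ ≤ suc ∣ p - x ∣
∣p∣≤1+∣p-x∣ p x = begin
  ∣ p ∣                     ≤⟨ ∣p∣≤∣p∪q∣ p ⁅ x ⁆ ⟩
  ∣ p ∪ ⁅ x ⁆ ∣             ≡⟨ ∣p─q∣+∣q∣≡∣p∪q∣ p ⁅ x ⁆ ⟨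
  ∣ p - x ∣ + ∣ ⁅ x ⁆ ∣     ≡⟨ cong (∣ p - x ∣ +_) (∣⁅x⁆∣≡1 x) ⟩
  ∣ p - x ∣ + 1             ≡⟨ ℕ.+-comm ∣ p - x ∣ 1 ⟩
  suc ∣ p - x ∣             ∎
  where open ℕ.≤-Reasoning

disjoint⇒p─q≡p : ∀ (p q : Subset n) → (∀ {x} → x ∈ p → x ∉ q) → p ─ q ≡ p
disjoint⇒p─q≡p p q disjoint =
  ⊆-antisym (p─q⊆p p q) (λ x∈p → x∈p∧x∉q⇒x∈p─q x∈p (disjoint x∈p))

p∪[q─p]≡p∪q : ∀ (p q : Subset n) → p ∪ (q ─ p) ≡ p ∪ q
p∪[q─p]≡p∪q []          []      = refl
p∪[q─p]≡p∪q (true  ∷ p) (_ ∷ q) = cong (true ∷_) (p∪[q─p]≡p∪q p q)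
p∪[q─p]≡p∪q (false ∷ p) (y ∷ q) = cong (y ∷_) (p∪[q─p]≡p∪q p q)

∁[p∪q]⊆∁p─q : ∀ (p q : Subset n) → ∁ (p ∪ q) ⊆ ∁ p ─ q
∁[p∪q]⊆∁p─q p q x∈ = x∈p∧x∉q⇒x∈p─q
  (x∉p⇒x∈∁p (λ x∈p → x∈∁p⇒x∉p x∈ (x∈p∪q⁺ (inj₁ x∈p))))
  (λ x∈q → x∈∁p⇒x∉p x∈ (x∈p∪q⁺ (inj₂ x∈q)))

⁅x⁆⊆p : ∀ {x : Fin n} {p} → x ∈ p → ⁅ x ⁆ ⊆ p
⁅x⁆⊆p {x = x} x∈p y∈⁅x⁆ = subst (_∈ _) (sym (x∈⁅y⁆⇒x≡y x y∈⁅x⁆)) x∈p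

Empty⇒∣p∣≡0 : ∀ {p : Subset n} → Empty p → ∣ p ∣ ≡ 0
Empty⇒∣p∣≡0 {n} p-empty = trans (cong ∣_∣ (Empty-unique p-empty)) (∣⊥∣≡0 n)

Empty⇒∣p∣≤m : ∀ {p : Subset n} {m} → Empty p → ∣ p ∣ ≤ m
Empty⇒∣p∣≤m p-empty = subst (_≤ _) (sym (Empty⇒∣p∣≡0 p-empty)) z≤n

Nonempty⇒0<∣p∣ : ∀ {p : Subset n} → Nonempty p → 0 < ∣ p ∣
Nonempty⇒0<∣p∣ (x , x∈p) = subst (_≤ _) (∣⁅x⁆∣≡1 x) (p⊆q⇒∣p∣≤∣q∣ (⁅x⁆⊆p x∈p))

0<∣p∣⇒Nonempty : ∀ {p : Subset n} → 0 < ∣ p ∣ → Nonempty p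
0<∣p∣⇒Nonempty {p = p} 0<∣p∣ with nonempty? p
... | yes p-nonempty = p-nonempty
... | no  p-empty    = ⊥-elim (ℕ.<-irrefl (sym (Empty⇒∣p∣≡0 p-empty)) 0<∣p∣)

⊆-img : ∀ (G : SetMap n k) W {x} → x ∈ W → G x ⊆ img G W
⊆-img G (true  ∷ W) here       y∈ = x∈p∪q⁺ (inj₁ y∈)
⊆-img G (true  ∷ W) (there x∈) y∈ = x∈p∪q⁺ (inj₂ (⊆-img (G ∘ fsuc) W x∈ y∈))
⊆-img G (false ∷ W) (there x∈) y∈ = ⊆-img (G ∘ fsuc) W x∈ y∈

img⁻ : ∀ (G : SetMap n k) W {y} → y ∈ img G W → ∃[ x ] x ∈ W × y ∈ G x
img⁻ {zero}  G []          y∈ = ⊥-elim (∉⊥ y∈)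
img⁻ {suc n} G (true  ∷ W) y∈ with x∈p∪q⁻ (G fzero) _ y∈
... | inj₁ y∈G0 = fzero , here , y∈G0
... | inj₂ y∈   with img⁻ (G ∘ fsuc) W y∈
...   | x , x∈ , y∈Gx = fsuc x , there x∈ , y∈Gx
img⁻ {suc n} G (false ∷ W) y∈ with img⁻ (G ∘ fsuc) W y∈
... | x , x∈ , y∈Gx = fsuc x , there x∈ , y∈Gx

img-mono : ∀ (G : SetMap n k) {A B} → A ⊆ B → img G A ⊆ img G B
img-mono G {A} {B} A⊆B y∈ with img⁻ G A y∈
... | x , x∈ , y∈Gx = ⊆-img G B (A⊆B x∈) y∈Gx

img-∪ : ∀ (G : SetMap n k) A B → img G (A ∪ B) ≡ img G A ∪ img G B
img-∪ G A B = ⊆-antisym ⊆∪ ∪⊆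
  where
  ⊆∪ : img G (A ∪ B) ⊆ img G A ∪ img G B
  ⊆∪ y∈ with img⁻ G (A ∪ B) y∈
  ... | x , x∈ , y∈Gx with x∈p∪q⁻ A B x∈
  ...   | inj₁ x∈A = x∈p∪q⁺ (inj₁ (⊆-img G A x∈A y∈Gx))
  ...   | inj₂ x∈B = x∈p∪q⁺ (inj₂ (⊆-img G B x∈B y∈Gx))
  ∪⊆ : img G A ∪ img G B ⊆ img G (A ∪ B)
  ∪⊆ y∈ with x∈p∪q⁻ (img G A) (img G B) y∈
  ... | inj₁ y∈A = img-mono G (p⊆p∪q B) y∈A
  ... | inj₂ y∈B = img-mono G (q⊆p∪q A B) y∈B

img-⁅⁆ : ∀ (G : SetMap n k) x → img G ⁅ x ⁆ ≡ G x
img-⁅⁆ G x = ⊆-antisym ⊆Gx (⊆-img G ⁅ x ⁆ (x∈⁅x⁆ x))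
  where
  ⊆Gx : img G ⁅ x ⁆ ⊆ G x
  ⊆Gx y∈ with img⁻ G ⁅ x ⁆ y∈
  ... | z , z∈ , y∈Gz = subst (λ w → _ ∈ G w) (x∈⁅y⁆⇒x≡y x z∈) y∈Gz

img-─ : ∀ (G : SetMap n k) C W → img (λ x → G x ─ C) W ≡ img G W ─ C
img-─ G C W = ⊆-antisym ⊆─ ─⊆
  where
  ⊆─ : img (λ x → G x ─ C) W ⊆ img G W ─ C
  ⊆─ y∈ with img⁻ (λ x → G x ─ C) W y∈
  ... | x , x∈ , y∈ =
    x∈p∧x∉q⇒x∈p─q (⊆-img G W x∈ (p─q⊆p (G x) C y∈)) (x∈p─q⇒x∉q (G x) C y∈)
  ─⊆ : img G W ─ C ⊆ img (λ x → G x ─ C) W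
  ─⊆ y∈ with img⁻ G W (p─q⊆p _ C y∈)
  ... | x , x∈ , y∈Gx =
    ⊆-img (λ x → G x ─ C) W x∈ (x∈p∧x∉q⇒x∈p─q y∈Gx (x∈p─q⇒x∉q _ C y∈))

img-⊥ : ∀ (G : SetMap n k) → img G ⊥ ≡ ⊥
img-⊥ {zero}  G = refl
img-⊥ {suc n} G = img-⊥ (G ∘ fsuc)

img-cong : ∀ {G H : SetMap n k} → (∀ x → G x ≡ H x) → ∀ W → img G W ≡ img H W
img-cong {zero}  G≡H []          = refl
img-cong {suc n} G≡H (true  ∷ W) = cong₂ _∪_ (G≡H fzero) (img-cong (G≡H ∘ fsuc) W)
img-cong {suc n} G≡H (false ∷ W) = img-cong (G≡H ∘ fsuc) W

reduce-⊥ : ∀ (F : SetMap n k) x → reduce F ⊥ x ≡ F x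
reduce-⊥ F x = trans (cong (F x ─_) (img-⊥ F)) (p─⊥≡p (F x))

reduce-reduce : ∀ (F : SetMap n k) P W x → reduce (reduce F P) W x ≡ reduce F (P ∪ W) x
reduce-reduce F P W x = begin
  F x ─ img F P ─ img (reduce F P) W          ≡⟨ cong (F x ─ img F P ─_) (img-─ F (img F P) W) ⟩
  F x ─ img F P ─ (img F W ─ img F P)         ≡⟨ p─q─r≡p─q∪r (F x) (img F P) _ ⟩
  F x ─ (img F P ∪ (img F W ─ img F P))       ≡⟨ cong (F x ─_) (p∪[q─p]≡p∪q (img F P) (img F W)) ⟩
  F x ─ (img F P ∪ img F W)                   ≡⟨ cong (F x ─_) (img-∪ F P W) ⟨
  F x ─ img F (P ∪ W)                         ∎
  where open ≡-Reasoning

HallOn : Subset n → SetMap n k → Set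
HallOn D G = ∀ W → W ⊆ D → ∣ W ∣ ≤ ∣ img G W ∣

record Matching (D : Subset n) (G : SetMap n k) : Set where
  field
    select    : Fin n → Fin k
    select∈   : ∀ {x} → x ∈ D → select x ∈ G x
    injective : ∀ {x y} → x ∈ D → y ∈ D → select x ≡ select y → x ≡ y

critical? : ∀ (D : Subset n) (G : SetMap n k) → Decidable (Critical D G)
critical? D G V = (V ⊆? D) ×-dec (nonempty? V ×-dec (∣ img G V ∣ ℕ.≟ ∣ V ∣))

HallOn-⊆ : ∀ {D V : Subset n} {G : SetMap n k} → V ⊆ D → HallOn D G → HallOn V G
HallOn-⊆ V⊆D hall W W⊆V = hall W (⊆-trans W⊆V V⊆D)

HallOn-cong : ∀ {D : Subset n} {G H : SetMap n k} → (∀ x → G x ≡ H x) → HallOn D G → HallOn D H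
HallOn-cong G≡H hall W W⊆D = subst (λ A → ∣ W ∣ ≤ ∣ A ∣) (img-cong G≡H W) (hall W W⊆D)

HallOn⇒Nonempty : ∀ {D : Subset n} {G : SetMap n k} → HallOn D G → ∀ {x} → x ∈ D → Nonempty (G x)
HallOn⇒Nonempty {G = G} hall {x} x∈D = 0<∣p∣⇒Nonempty
  (subst₂ _≤_ (∣⁅x⁆∣≡1 x) (cong ∣_∣ (img-⁅⁆ G x)) (hall ⁅ x ⁆ (⁅x⁆⊆p x∈D)))

HallOn-reduce : ∀ {D V : Subset n} {G : SetMap n k} → HallOn D G → V ⊆ D →
  ∣ img G V ∣ ≡ ∣ V ∣ → HallOn (D ─ V) (reduce G V)
HallOn-reduce {D = D} {V} {G} hall V⊆D V-tight W W⊆ = ℕ.+-cancelʳ-≤ ∣ V ∣ ∣ W ∣ _ (begin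
  ∣ W ∣ + ∣ V ∣                          ≡⟨ cong (λ A → ∣ A ∣ + ∣ V ∣) W─V≡W ⟨
  ∣ W ─ V ∣ + ∣ V ∣                      ≡⟨ ∣p─q∣+∣q∣≡∣p∪q∣ W V ⟩
  ∣ W ∪ V ∣                              ≤⟨ hall (W ∪ V) W∪V⊆D ⟩
  ∣ img G (W ∪ V) ∣                      ≡⟨ cong ∣_∣ (img-∪ G W V) ⟩
  ∣ img G W ∪ img G V ∣                  ≡⟨ ∣p─q∣+∣q∣≡∣p∪q∣ (img G W) (img G V) ⟨
  ∣ img G W ─ img G V ∣ + ∣ img G V ∣    ≡⟨ cong₂ _+_ (cong ∣_∣ (img-─ G (img G V) W)) (sym V-tight) ⟨
  ∣ img (reduce G V) W ∣ + ∣ V ∣         ∎)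
  where
  open ℕ.≤-Reasoning
  W─V≡W : W ─ V ≡ W
  W─V≡W = disjoint⇒p─q≡p W V (λ x∈W → x∈p─q⇒x∉q D V (W⊆ x∈W))
  W∪V⊆D : W ∪ V ⊆ D
  W∪V⊆D x∈ with x∈p∪q⁻ W V x∈
  ... | inj₁ x∈W = p─q⊆p D V (W⊆ x∈W)
  ... | inj₂ x∈V = V⊆D x∈V

HallOn-delete : ∀ {D : Subset n} {G : SetMap n k} → HallOn D G →
  (∀ V → V ⊂ D → ¬ Critical D G V) → ∀ {x} → x ∈ D → ∀ y →
  HallOn (D - x) (λ z → G z ─ ⁅ y ⁆)
HallOn-delete {G = G} hall noCritical x∈D y W W⊆ with nonempty? W
... | no  W-empty    = Empty⇒∣p∣≤m W-empty
... | yes W-nonempty = ℕ.≤-pred (begin-strict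
  ∣ W ∣                              <⟨ surplus ⟩
  ∣ img G W ∣                        ≤⟨ ∣p∣≤1+∣p-x∣ (img G W) y ⟩
  suc ∣ img G W - y ∣                ≡⟨ cong (suc ∘ ∣_∣) (img-─ G ⁅ y ⁆ W) ⟨
  suc ∣ img (λ z → G z ─ ⁅ y ⁆) W ∣  ∎)
  where
  open ℕ.≤-Reasoning
  W⊂D = ⊆-⊂-trans W⊆ (x∈p⇒p-x⊂p x∈D)
  surplus : ∣ W ∣ < ∣ img G W ∣
  surplus = ℕ.≤∧≢⇒< (hall W (p⊂q⇒p⊆q W⊂D))
    (λ tight → noCritical W W⊂D (p⊂q⇒p⊆q W⊂D , W-nonempty , sym tight))

-- Hall's theorem

singleton-matching : ∀ {G : SetMap n k} {x y} → y ∈ G x → Matching ⁅ x ⁆ G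
singleton-matching {G = G} {x} {y} y∈Gx = record
  { select    = λ _ → y
  ; select∈   = λ z∈ → subst (λ w → y ∈ G w) (sym (x∈⁅y⁆⇒x≡y x z∈)) y∈Gx
  ; injective = λ z∈ w∈ _ → trans (x∈⁅y⁆⇒x≡y x z∈) (sym (x∈⁅y⁆⇒x≡y x w∈))
  }

matching-glue : ∀ {D V : Subset n} {G : SetMap n k} {C} → V ⊆ D → (m : Matching V G) →
  (∀ {x} → x ∈ V → Matching.select m x ∈ C) → Matching (D ─ V) (λ x → G x ─ C) → Matching D G
matching-glue {D = D} {V} {G} {C} V⊆D m₁ m₁∈C m₂ = record
  { select = select ; select∈ = select∈ ; injective = injective }
  where
  module M₁ = Matching m₁
  module M₂ = Matching m₂
  out-of-V : ∀ {x} → x ∈ D → x ∉ V → x ∈ D ─ V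
  out-of-V = x∈p∧x∉q⇒x∈p─q
  select : Fin _ → Fin _
  select x with x ∈? V
  ... | yes _ = M₁.select x
  ... | no  _ = M₂.select x
  select∈ : ∀ {x} → x ∈ D → select x ∈ G x
  select∈ {x} x∈D with x ∈? V
  ... | yes x∈V = M₁.select∈ x∈V
  ... | no  x∉V = p─q⊆p (G x) C (M₂.select∈ (out-of-V x∈D x∉V))
  separated : ∀ {x y} → x ∈ V → y ∈ D → y ∉ V → M₁.select x ≢ M₂.select y
  separated {y = y} x∈V y∈D y∉V eq =
    x∈p─q⇒x∉q (G y) C (M₂.select∈ (out-of-V y∈D y∉V)) (subst (_∈ C) eq (m₁∈C x∈V))
  injective : ∀ {x y} → x ∈ D → y ∈ D → select x ≡ select y → x ≡ y
  injective {x} {y} x∈D y∈D eq with x ∈? V | y ∈? V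
  ... | yes x∈V | yes y∈V = M₁.injective x∈V y∈V eq
  ... | yes x∈V | no  y∉V = ⊥-elim (separated x∈V y∈D y∉V eq)
  ... | no  x∉V | yes y∈V = ⊥-elim (separated y∈V x∈D x∉V (sym eq))
  ... | no  x∉V | no  y∉V = M₂.injective (out-of-V x∈D x∉V) (out-of-V y∈D y∉V) eq

-- The codomain is nonempty so that an empty domain still has a (junk) selection.
HallOn⇒Matching : ∀ {D : Subset n} {G : SetMap n (suc k)} → HallOn D G → Matching D G
HallOn⇒Matching {D = D} hall = go (⊂-wellFounded D) hall
  where
  go : ∀ {D} {G : SetMap _ (suc _)} → Acc _⊂_ D → HallOn D G → Matching D G
  go {D} {G} (acc rec) hall with nonempty? D
  ... | no D-empty = record
    { select    = λ _ → fzero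
    ; select∈   = λ x∈D → ⊥-elim (D-empty (_ , x∈D))
    ; injective = λ x∈D _ _ → ⊥-elim (D-empty (_ , x∈D))
    }
  ... | yes (x , x∈D) with anySubset? (λ V → (V ⊂? D) ×-dec critical? D G V)
  ...   | yes (V , V⊂D , V⊆D , (v , v∈V) , V-tight) =
    matching-glue V⊆D m₁ (λ x∈V → ⊆-img G V x∈V (Matching.select∈ m₁ x∈V)) m₂
    where
    m₁ = go (rec V⊂D) (HallOn-⊆ V⊆D hall)
    m₂ = go (rec (p∩q≢∅⇒p─q⊂p D V (v , x∈p∩q⁺ (V⊆D v∈V , v∈V))))
            (HallOn-reduce hall V⊆D V-tight)
  ...   | no noCritical =
    matching-glue (⁅x⁆⊆p x∈D) (singleton-matching y∈Gx) (λ _ → x∈⁅x⁆ y) m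
    where
    y∈Gx = proj₂ (HallOn⇒Nonempty hall x∈D)
    y = proj₁ (HallOn⇒Nonempty hall x∈D)
    m = go (rec (x∈p⇒p-x⊂p x∈D))
      (HallOn-delete hall (λ V V⊂D V-critical → noCritical (V , V⊂D , V-critical)) x∈D y)

-- Alldifferent selections

∣img⁅s⁆∣≡∣W∣ : ∀ (s : Fin n → Fin k) → Injective _≡_ _≡_ s → ∀ W →
  ∣ img (λ x → ⁅ s x ⁆) W ∣ ≡ ∣ W ∣
∣img⁅s⁆∣≡∣W∣ {zero}  {k} s s-inj []          = ∣⊥∣≡0 k
∣img⁅s⁆∣≡∣W∣ {suc n}     s s-inj (false ∷ W) =
  ∣img⁅s⁆∣≡∣W∣ (s ∘ fsuc) (suc-injective ∘ s-inj) W
∣img⁅s⁆∣≡∣W∣ {suc n}     s s-inj (true  ∷ W) = begin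
  ∣ ⁅ s fzero ⁆ ∪ rest ∣             ≡⟨ ∣p─q∣+∣q∣≡∣p∪q∣ ⁅ s fzero ⁆ rest ⟨
  ∣ ⁅ s fzero ⁆ ─ rest ∣ + ∣ rest ∣  ≡⟨ cong (λ A → ∣ A ∣ + ∣ rest ∣) (disjoint⇒p─q≡p _ rest fresh) ⟩
  ∣ ⁅ s fzero ⁆ ∣ + ∣ rest ∣         ≡⟨ cong₂ _+_ (∣⁅x⁆∣≡1 (s fzero)) ∣rest∣≡∣W∣ ⟩
  suc ∣ W ∣                          ∎
  where
  open ≡-Reasoning
  rest = img (λ x → ⁅ s (fsuc x) ⁆) W
  ∣rest∣≡∣W∣ : ∣ rest ∣ ≡ ∣ W ∣
  ∣rest∣≡∣W∣ = ∣img⁅s⁆∣≡∣W∣ (s ∘ fsuc) (suc-injective ∘ s-inj) W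
  fresh : ∀ {y} → y ∈ ⁅ s fzero ⁆ → y ∉ rest
  fresh {y} y∈ y∈rest with img⁻ (λ x → ⁅ s (fsuc x) ⁆) W y∈rest
  ... | x , _ , y∈′ with s-inj (trans (sym (x∈⁅y⁆⇒x≡y _ y∈)) (x∈⁅y⁆⇒x≡y _ y∈′))
  ... | ()

Alldifferent⇒Hall : ∀ (F : SetMap n k) → HasAlldifferentSelection F → HallCondition F
Alldifferent⇒Hall F (s , s∈F , s-inj) W =
  subst (_≤ ∣ img F W ∣) (∣img⁅s⁆∣≡∣W∣ s s-inj W) (p⊆q⇒∣p∣≤∣q∣ ⊆imgF)
  where
  ⊆imgF : img (λ x → ⁅ s x ⁆) W ⊆ img F W
  ⊆imgF y∈ with img⁻ (λ x → ⁅ s x ⁆) W y∈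
  ... | x , x∈W , y∈⁅sx⁆ = ⊆-img F W x∈W (subst (_∈ F x) (sym (x∈⁅y⁆⇒x≡y _ y∈⁅sx⁆)) (s∈F x))

-- From a Hall partition to an alldifferent selection

NonReducible⇒HallOn : ∀ {D W : Subset n} {G : SetMap n k} → NonReducible D G W →
  (∀ {x} → x ∈ W → Nonempty (G x)) → HallOn W G
NonReducible⇒HallOn {W = W} {G} (W⊆D , _ , noCritical) G-nonempty U U⊆W = go (⊂-wellFounded U) U⊆W
  where
  open ℕ.≤-Reasoning
  go : ∀ {U} → Acc _⊂_ U → U ⊆ W → ∣ U ∣ ≤ ∣ img G U ∣
  go {U} (acc rec) U⊆W with nonempty? U
  ... | no U-empty = Empty⇒∣p∣≤m U-empty
  ... | yes (x , x∈U) with nonempty? (U - x)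
  ...   | no U-x-empty = begin
    ∣ U ∣          ≤⟨ ∣p∣≤1+∣p-x∣ U x ⟩
    suc ∣ U - x ∣  ≡⟨ cong suc (Empty⇒∣p∣≡0 U-x-empty) ⟩
    1              ≤⟨ Nonempty⇒0<∣p∣ (G-nonempty (U⊆W x∈U)) ⟩
    ∣ G x ∣        ≤⟨ p⊆q⇒∣p∣≤∣q∣ (⊆-img G U x∈U) ⟩
    ∣ img G U ∣    ∎
  ...   | yes U-x-nonempty = begin
    ∣ U ∣              ≤⟨ ∣p∣≤1+∣p-x∣ U x ⟩
    suc ∣ U - x ∣      ≤⟨ ℕ.≤∧≢⇒< (go (rec U-x⊂U) (⊆-trans U-x⊆U U⊆W)) not-tight ⟩
    ∣ img G (U - x) ∣  ≤⟨ p⊆q⇒∣p∣≤∣q∣ (img-mono G U-x⊆U) ⟩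
    ∣ img G U ∣        ∎
    where
    U-x⊂U = x∈p⇒p-x⊂p x∈U
    U-x⊆U = p⊂q⇒p⊆q U-x⊂U
    U-x⊂W = ⊂-⊆-trans U-x⊂U U⊆W
    not-tight : ∣ U - x ∣ ≢ ∣ img G (U - x) ∣
    not-tight tight = noCritical (U - x) U-x⊂W
      (⊆-trans (p⊂q⇒p⊆q U-x⊂W) W⊆D , U-x-nonempty , sym tight)

⊆-prefixUnion : ∀ {m} (Ws : Fin m → Subset n) i t → toℕ i < t → Ws i ⊆ prefixUnion Ws t
⊆-prefixUnion {m = suc m} Ws fzero    (suc t) _   x∈ = x∈p∪q⁺ (inj₁ x∈)
⊆-prefixUnion {m = suc m} Ws (fsuc i) (suc t) i<t x∈ =
  x∈p∪q⁺ (inj₂ (⊆-prefixUnion (Ws ∘ fsuc) i t (ℕ.≤-pred i<t) x∈))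

HallPartition⇒Alldifferent : ∀ (F : SetMap n (suc k)) → HasHallPartition F → HasAlldifferentSelection F
HallPartition⇒Alldifferent F (m′ , Ws , partition) = select , select∈ , injective
  where
  open IsHallPartition partition
  removed : Fin (suc m′) → Subset _
  removed i = prefixUnion Ws (toℕ i)
  M : ∀ i → Matching (Ws i) (reduce F (removed i))
  M i = HallOn⇒Matching (NonReducible⇒HallOn (condII i) (condI i _))
  block : Fin _ → Fin (suc m′)
  block x = proj₁ (covers x)
  select : Fin _ → Fin _
  select x = Matching.select (M (block x)) x
  select∈F : ∀ i {x} → x ∈ Ws i → Matching.select (M i) x ∈ F x
  select∈F i {x} x∈ = p─q⊆p (F x) _ (Matching.select∈ (M i) x∈)
  select∈ : IsSelection F select
  select∈ x = select∈F (block x) (proj₂ (covers x))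
  -- Values on a later block avoid the image of every earlier block.
  separated : ∀ i j {x y} → toℕ i < toℕ j → x ∈ Ws i → y ∈ Ws j →
    Matching.select (M i) x ≢ Matching.select (M j) y
  separated i j {y = y} i<j x∈ y∈ eq = x∈p─q⇒x∉q (F y) _ (Matching.select∈ (M j) y∈)
    (subst (_∈ img F (removed j)) eq
      (⊆-img F (removed j) (⊆-prefixUnion Ws i (toℕ j) i<j x∈) (select∈F i x∈)))
  injective-on-blocks : ∀ i j {x y} → x ∈ Ws i → y ∈ Ws j →
    Matching.select (M i) x ≡ Matching.select (M j) y → x ≡ y
  injective-on-blocks i j x∈ y∈ eq with ℕ.<-cmp (toℕ i) (toℕ j)
  ... | tri< i<j _ _ = ⊥-elim (separated i j i<j x∈ y∈ eq)
  ... | tri> _ _ j<i = ⊥-elim (separated j i j<i y∈ x∈ (sym eq))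
  ... | tri≈ _ i≡j _ with toℕ-injective i≡j
  ...   | refl = Matching.injective (M i) x∈ y∈ eq
  injective : Injective _≡_ _≡_ select
  injective {x} {y} = injective-on-blocks (block x) (block y) (proj₂ (covers x)) (proj₂ (covers y))

-- From the Hall condition to a Hall partition

⊂-minimal : ∀ {ℓ} {Q : Pred (Subset n) ℓ} → Decidable Q → ∀ {V} → Q V →
  ∃[ W ] W ⊆ V × Q W × (∀ U → U ⊂ W → ¬ Q U)
⊂-minimal {Q = Q} Q? QV = go (⊂-wellFounded _) QV
  where
  go : ∀ {V} → Acc _⊂_ V → Q V → ∃[ W ] W ⊆ V × Q W × (∀ U → U ⊂ W → ¬ Q U)
  go {V} (acc rec) QV with anySubset? (λ U → (U ⊂? V) ×-dec Q? U)
  ... | no  none               = V , ⊆-refl , QV , λ U U⊂V QU → none (U , U⊂V , QU)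
  ... | yes (U , U⊂V , QU) with go (rec U⊂V) QU
  ...   | W , W⊆U , QW , minimal = W , ⊆-trans W⊆U (p⊂q⇒p⊆q U⊂V) , QW , minimal

-- A Hall partition of F_P on X ∖ P, written with the maps F_{P ∪ W_1 ∪ ⋯ ∪ W_{i-1}} so that
-- for P = ∅ it is literally a Hall partition of F.
removedBefore : ∀ {m} → Subset n → (Fin m → Subset n) → Fin m → Subset n
removedBefore P Ws i = P ∪ prefixUnion Ws (toℕ i)

record IsHallPartitionAfter {m′} (F : SetMap n k) (P : Subset n) (Ws : Fin (suc m′) → Subset n) : Set where
  field
    nonempty : ∀ i → Nonempty (Ws i)
    disjoint : ∀ i j → i ≢ j → ∀ {x} → x ∈ Ws i → x ∉ Ws j
    avoids   : ∀ i {x} → x ∈ Ws i → x ∉ P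
    covers   : ∀ x → x ∉ P → ∃[ i ] x ∈ Ws i
    condI    : ∀ i x → x ∈ Ws i → Nonempty (reduce F (removedBefore P Ws i) x)
    condII   : ∀ i → NonReducible (∁ (removedBefore P Ws i)) (reduce F (removedBefore P Ws i)) (Ws i)
    condIII  : ∀ i → suc (toℕ i) < suc m′ →
                 Critical (∁ (removedBefore P Ws i)) (reduce F (removedBefore P Ws i)) (Ws i)

IsHallPartitionAfter-⊥ : ∀ {m′} {F : SetMap n k} {Ws : Fin (suc m′) → Subset n} →
  IsHallPartitionAfter F ⊥ Ws → IsHallPartition F Ws
IsHallPartitionAfter-⊥ {F = F} {Ws} partition = record
  { nonempty = nonempty
  ; disjoint = λ i j i≢j → ⊆-antisym
      (λ x∈ → ⊥-elim (disjoint i j i≢j (proj₁ (x∈p∩q⁻ _ _ x∈)) (proj₂ (x∈p∩q⁻ _ _ x∈))))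
      (⊆-min _)
  ; covers   = λ x → covers x ∉⊥
  ; condI    = λ i x x∈ → subst (λ Q → Nonempty (reduce F Q x)) (∪-identityˡ _) (condI i x x∈)
  ; condII   = λ i → subst (λ Q → NonReducible (∁ Q) (reduce F Q) (Ws i)) (∪-identityˡ _) (condII i)
  ; condIII  = λ i i<m → subst (λ Q → Critical (∁ Q) (reduce F Q) (Ws i)) (∪-identityˡ _) (condIII i i<m)
  }
  where open IsHallPartitionAfter partition

subst-∪⊥ : ∀ {ℓ} (Q : Subset n → Set ℓ) {P} → Q P → Q (P ∪ ⊥)
subst-∪⊥ Q {P} = subst Q (sym (∪-identityʳ P))

module _ (F : SetMap n k) where

  HallPartitionAfter : Subset n → Set
  HallPartitionAfter P = Σ ℕ λ m′ → Σ (Fin (suc m′) → Subset n) (IsHallPartitionAfter F P)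

  last-block : ∀ {P} → Nonempty (∁ P) → HallOn (∁ P) (reduce F P) →
    (∀ V → V ⊂ ∁ P → ¬ Critical (∁ P) (reduce F P) V) → HallPartitionAfter P
  last-block {P} rest-nonempty hall noCritical = 0 , (λ _ → ∁ P) , record
    { nonempty = λ _ → rest-nonempty
    ; disjoint = λ { fzero fzero 0≢0 → ⊥-elim (0≢0 refl) }
    ; avoids   = λ _ → x∈∁p⇒x∉p
    ; covers   = λ x x∉P → fzero , x∉p⇒x∈∁p x∉P
    ; condI    = λ { fzero x x∈ → subst-∪⊥ (λ Q → Nonempty (reduce F Q x)) (HallOn⇒Nonempty hall x∈) }
    ; condII   = λ { fzero → subst-∪⊥ (λ Q → NonReducible (∁ Q) (reduce F Q) (∁ P))
                               (⊆-refl , rest-nonempty , noCritical) }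
    ; condIII  = λ { fzero (s≤s ()) }
    }

  cons-block : ∀ {P W m′} {Ws : Fin (suc m′) → Subset n} → W ⊆ ∁ P →
    (∀ {x} → x ∈ W → Nonempty (reduce F P x)) →
    NonReducible (∁ P) (reduce F P) W → Critical (∁ P) (reduce F P) W →
    IsHallPartitionAfter F (P ∪ W) Ws → IsHallPartitionAfter F P (W Vector.∷ Ws)
  cons-block {P} {W} {m′} {Ws} W⊆∁P W-values W-nonreducible W-critical partition = record
    { nonempty = λ { fzero → proj₁ (proj₂ W-nonreducible) ; (fsuc j) → R.nonempty j }
    ; disjoint = λ
        { fzero    fzero    0≢0 → ⊥-elim (0≢0 refl)
        ; fzero    (fsuc j) _   x∈W x∈  → W∩later j x∈W x∈
        ; (fsuc i) fzero    _   x∈ x∈W  → W∩later i x∈W x∈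
        ; (fsuc i) (fsuc j) i≢j → R.disjoint i j (i≢j ∘ cong fsuc)
        }
    ; avoids   = λ { fzero x∈W → x∈∁p⇒x∉p (W⊆∁P x∈W)
                   ; (fsuc j) x∈ x∈P → R.avoids j x∈ (x∈p∪q⁺ (inj₁ x∈P)) }
    ; covers   = covers
    ; condI    = condI
    ; condII   = condII
    ; condIII  = condIII
    }
    where
    module R = IsHallPartitionAfter partition
    subst-∪-assoc : ∀ {ℓ} (j : Fin (suc m′)) (Q : Subset n → Set ℓ) →
      Q ((P ∪ W) ∪ prefixUnion Ws (toℕ j)) →
      Q (P ∪ (W ∪ prefixUnion Ws (toℕ j)))
    subst-∪-assoc j Q = subst Q (∪-assoc P W _)
    removed : Fin (suc (suc m′)) → Subset n
    removed = removedBefore P (W Vector.∷ Ws)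
    condI : ∀ i x → x ∈ (W Vector.∷ Ws) i → Nonempty (reduce F (removed i) x)
    condI fzero    x x∈W = subst-∪⊥ (λ Q → Nonempty (reduce F Q x)) (W-values x∈W)
    condI (fsuc j) x x∈  = subst-∪-assoc j (λ Q → Nonempty (reduce F Q x)) (R.condI j x x∈)
    condII : ∀ i → NonReducible (∁ (removed i)) (reduce F (removed i)) ((W Vector.∷ Ws) i)
    condII fzero    = subst-∪⊥ (λ Q → NonReducible (∁ Q) (reduce F Q) W) W-nonreducible
    condII (fsuc j) = subst-∪-assoc j (λ Q → NonReducible (∁ Q) (reduce F Q) (Ws j)) (R.condII j)
    condIII : ∀ i → suc (toℕ i) < suc (suc m′) →
      Critical (∁ (removed i)) (reduce F (removed i)) ((W Vector.∷ Ws) i)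
    condIII fzero    _   = subst-∪⊥ (λ Q → Critical (∁ Q) (reduce F Q) W) W-critical
    condIII (fsuc j) j<m =
      subst-∪-assoc j (λ Q → Critical (∁ Q) (reduce F Q) (Ws j)) (R.condIII j (ℕ.≤-pred j<m))
    W∩later : ∀ j {x} → x ∈ W → x ∉ Ws j
    W∩later j x∈W x∈ = R.avoids j x∈ (x∈p∪q⁺ (inj₂ x∈W))
    covers : ∀ x → x ∉ P → ∃[ i ] x ∈ (W Vector.∷ Ws) i
    covers x x∉P with x ∈? W
    ... | yes x∈W = fzero , x∈W
    ... | no  x∉W with R.covers x (λ x∈ → [ x∉P , x∉W ] (x∈p∪q⁻ P W x∈))
    ...   | j , x∈ = fsuc j , x∈

  hallPartitionAfter : ∀ {P} → Acc _⊃_ P → Nonempty (∁ P) → HallOn (∁ P) (reduce F P) →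
    HallPartitionAfter P
  hallPartitionAfter {P} (acc rec) rest-nonempty hall
    with anySubset? (λ V → (V ⊂? ∁ P) ×-dec critical? (∁ P) (reduce F P) V)
  ... | no noCritical =
    last-block rest-nonempty hall (λ V V⊂ V-critical → noCritical (V , V⊂ , V-critical))
  ... | yes (V , (V⊆∁P , z , z∈∁P , z∉V) , V-critical)
    with ⊂-minimal (critical? (∁ P) (reduce F P)) V-critical
  ...   | W , W⊆V , W-critical@(W⊆∁P , (w , w∈W) , W-tight) , W-minimal
    with hallPartitionAfter (rec P⊂P∪W) (z , z∈∁[P∪W]) hall-after
    where
    P⊂P∪W : P ⊂ P ∪ W
    P⊂P∪W = p⊆p∪q W , w , x∈p∪q⁺ (inj₂ w∈W) , x∈∁p⇒x∉p (W⊆∁P w∈W)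
    z∈∁[P∪W] : z ∈ ∁ (P ∪ W)
    z∈∁[P∪W] = x∉p⇒x∈∁p (λ z∈ → [ x∈∁p⇒x∉p z∈∁P , z∉V ∘ W⊆V ] (x∈p∪q⁻ P W z∈))
    hall-after : HallOn (∁ (P ∪ W)) (reduce F (P ∪ W))
    hall-after = HallOn-cong (reduce-reduce F P W)
      (HallOn-⊆ (∁[p∪q]⊆∁p─q P W) (HallOn-reduce hall W⊆∁P W-tight))
  ...     | m′ , Ws , partition = suc m′ , W Vector.∷ Ws ,
    cons-block W⊆∁P (λ x∈W → HallOn⇒Nonempty hall (W⊆∁P x∈W))
      (W⊆∁P , (w , w∈W) , W-minimal) W-critical partition

Hall⇒HallPartition : ∀ (F : SetMap (suc n) k) → HallCondition F → HasHallPartition F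
Hall⇒HallPartition F hall
  with hallPartitionAfter F (⊃-wellFounded ⊥) (fzero , x∉p⇒x∈∁p ∉⊥)
         (HallOn-cong (λ x → sym (reduce-⊥ F x)) (λ W _ → hall W))
... | m′ , Ws , partition = m′ , Ws , IsHallPartitionAfter-⊥ partition

theorem4p2 : (n k : ℕ) (F : SetMap (suc n) (suc k)) →
    (HallCondition F ⇔ HasHallPartition F) × (HasHallPartition F ⇔ HasAlldifferentSelection F)
theorem4p2 n k F =
  mk⇔ (Hall⇒HallPartition F) (Alldifferent⇒Hall F ∘ HallPartition⇒Alldifferent F) ,
  mk⇔ (HallPartition⇒Alldifferent F) (Hall⇒HallPartition F ∘ Alldifferent⇒Hall F)
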